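{- If $\varphi$ is a partial proper $3$-edge coloring of $Q_3$ in which all colored edges are contained in the union of two dimensional matchings, then $\varphi$ is avoidable.
   Context: $Q_3$ is the cube graph with vertex set $\{0,1\}^3$, vertices adjacent iff they differ in exactly one coordinate; the $i$-th dimensional matching consists of the edges whose endpoints differ in coordinate $i$. A partial proper $3$-edge coloring assigns colors from $\{1,2,3\}$ to some edges so that adjacent colored edges get different colors. It is avoidable if there is a proper $3$-edge coloring $f$ of $Q_3$ with colors $1,2,3$ such that $f(e)\neq\varphi(e)$ for every colored edge $e$. -}

module Defs where

open import Data.Bool using (Bool; true; false; not)
open import Data.Fin using (Fin)
open import Data.Vec using (Vec; lookup; _[_]%=_)
open import Data.Maybe using (Maybe; just; nothing)
open import Data.Product using (Σ; _×_; _,_)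
open import Data.Sum using (_⊎_)
open import Relation.Binary.PropositionalEquality using (_≡_; _≢_)

Vertex : Set
Vertex = Vec Bool 3

Color : Set
Color = Fin 3

flipAt : Fin 3 → Vertex → Vertex
flipAt i v = v [ i ]%= not

-- An edge of Q₃: a direction i and its endpoint with i-th coordinate 0.
-- The edge joins  low  and  flipAt i low ; it lies in the i-th dimensional matching.
record Edge : Set where
  constructor edge
  field
    dir  : Fin 3
    low  : Vertex
    low0 : lookup low dir ≡ false
open Edge public

high : Edge → Vertex
high e = flipAt (dir e) (low e)

_∈ₑ_ : Vertex → Edge → Set
v ∈ₑ e = (v ≡ low e) ⊎ (v ≡ high e)

SameEdge : Edge → Edge → Set
SameEdge e f = (dir e ≡ dir f) × (low e ≡ low f)

Adjacent : Edge → Edge → Set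
Adjacent e f = (SameEdge e f → Data.Empty.⊥) × Σ Vertex (λ v → (v ∈ₑ e) × (v ∈ₑ f))
  where import Data.Empty

IsProper : (Edge → Color) → Set
IsProper f = ∀ e g → Adjacent e g → f e ≢ f g

PartialColoring : Set
PartialColoring = Edge → Maybe Color

IsProperPartial : PartialColoring → Set
IsProperPartial φ = ∀ e g c d → Adjacent e g → φ e ≡ just c → φ g ≡ just d → c ≢ d

Avoidable : PartialColoring → Set
Avoidable φ = Σ (Edge → Color) λ f → IsProper f × (∀ e c → φ e ≡ just c → f e ≢ c)

ColoredWithin : PartialColoring → Fin 3 → Fin 3 → Set
ColoredWithin φ i j = ∀ e c → φ e ≡ just c → (dir e ≡ i) ⊎ (dir e ≡ j)

module Submission where

-- Since the colored edges lie in two dimensional matchings, some direction k carries no colored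
-- edge. The two faces orthogonal to k are 4-cycles whose edges alternate between the two remaining
-- directions. Giving every k-edge color c and, on each face, one of the two other colors to each of
-- its directions yields a proper 3-edge coloring. On a face, the colors of its two directions form
-- disjoint sets X and Y, and c is blocked only if X or Y is the whole complement of c; so at most
-- one c is blocked per face, and with three colors some c is unblocked on both faces.

open import Defs
open import Data.Bool using (Bool; true; false; not)
open import Data.Bool.Properties using () renaming (_≟_ to _≟ᵇ_)
open import Data.Empty using (⊥-elim)
open import Data.Fin using (Fin; zero; suc; punchIn; punchOut)
open import Data.Nat using (_+_)
open import Data.Fin.Properties
  using (_≟_; 0≢1+n; all?; any?; punchInᵢ≢i; punchIn-injective; punchOut-injective; punchOut-cong;
         punchIn-punchOut; punchOut-punchIn)
open import Data.Maybe using (Maybe; just; nothing)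
open import Data.Maybe.Properties using () renaming (≡-dec to ≡-dec-Maybe)
open import Data.Product using (Σ; ∃; ∃₂; _×_; _,_)
open import Data.Sum using (_⊎_; inj₁; inj₂; [_,_]′)
open import Data.Vec using (Vec; []; _∷_; lookup; insertAt; removeAt; updateAt; _[_]≔_)
open import Data.Vec.Properties
  using (insertAt-lookup; insertAt-punchIn; insertAt-removeAt; removeAt-punchOut;
         lookup∘updateAt′; updateAt-id-local; updateAt-updateAt)
open import Function using (_∘_)
open import Level using (0ℓ)
open import Relation.Nullary using (Dec; yes; no; ¬?; _×-dec_; _⊎-dec_; _→-dec_)
open import Relation.Nullary.Decidable using (map′; from-yes)
open import Relation.Unary using (Pred; Decidable)
open import Relation.Binary.PropositionalEquality
  using (_≡_; _≢_; refl; sym; trans; cong; cong₂; subst; module ≡-Reasoning)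
open import Axiom.UniquenessOfIdentityProofs using (module Decidable⇒UIP)

updateAt-insertAt : ∀ {A : Set} {n} (xs : Vec A n) i v (f : A → A) →
  updateAt (insertAt xs i v) i f ≡ insertAt xs i (f v)
updateAt-insertAt xs       zero    v f = refl
updateAt-insertAt (x ∷ xs) (suc i) v f = cong (x ∷_) (updateAt-insertAt xs i v f)

updateAt-insertAt-punchIn : ∀ {A : Set} {n} (xs : Vec A n) i j v (f : A → A) →
  updateAt (insertAt xs i v) (punchIn i j) f ≡ insertAt (updateAt xs j f) i v
updateAt-insertAt-punchIn xs       zero    j       v f = refl
updateAt-insertAt-punchIn (x ∷ xs) (suc i) zero    v f = refl
updateAt-insertAt-punchIn (x ∷ xs) (suc i) (suc j) v f =
  cong (x ∷_) (updateAt-insertAt-punchIn xs i j v f)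

edge-≡ : ∀ {e f} → dir e ≡ dir f → low e ≡ low f → e ≡ f
edge-≡ {edge d l p} {edge _ _ q} refl refl = cong (edge d l) (Decidable⇒UIP.≡-irrelevant _≟ᵇ_ p q)

endpoint-reset : ∀ {v} e → v ∈ₑ e → v [ dir e ]≔ false ≡ low e
endpoint-reset (edge d l l₀) (inj₁ refl) = updateAt-id-local d l (sym l₀)
endpoint-reset (edge d l l₀) (inj₂ refl) = trans (updateAt-updateAt d l) (updateAt-id-local d l (sym l₀))

sharedEndpoint⇒SameEdge : ∀ {v} e g → dir e ≡ dir g → v ∈ₑ e → v ∈ₑ g → SameEdge e g
sharedEndpoint⇒SameEdge {v} e g d≡d′ v∈e v∈g =
  d≡d′ , trans (sym (endpoint-reset e v∈e)) (trans (cong (v [_]≔ false) d≡d′) (endpoint-reset g v∈g))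

endpoint-lookup : ∀ {v k} e → k ≢ dir e → v ∈ₑ e → lookup v k ≡ lookup (low e) k
endpoint-lookup         e k≢d (inj₁ refl) = refl
endpoint-lookup {k = k} e k≢d (inj₂ refl) = lookup∘updateAt′ k (dir e) k≢d (low e)

-- faceEdge k t j b lies on the face x_k = t, runs in direction punchIn k j, and has b as its
-- coordinate in the face's other direction.
faceEdge : Fin 3 → Bool → Fin 2 → Bool → Edge
faceEdge k t j b = edge (punchIn k j) (insertAt (insertAt (b ∷ []) j false) k t)
  (trans (insertAt-punchIn _ k t j) (insertAt-lookup (b ∷ []) j false))

faceEdge-endpoint : ∀ k t j b x → insertAt (insertAt (b ∷ []) j x) k t ∈ₑ faceEdge k t j b
faceEdge-endpoint k t j b false = inj₁ refl
faceEdge-endpoint k t j b true  = inj₂ (sym (begin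
  updateAt (insertAt (insertAt (b ∷ []) j false) k t) (punchIn k j) not
    ≡⟨ updateAt-insertAt-punchIn _ k j t not ⟩
  insertAt (updateAt (insertAt (b ∷ []) j false) j not) k t
    ≡⟨ cong (λ w → insertAt w k t) (updateAt-insertAt (b ∷ []) j false not) ⟩
  insertAt (insertAt (b ∷ []) j true) k t ∎))
  where open ≡-Reasoning

faceEdges-adjacent : ∀ k t a b → Adjacent (faceEdge k t zero a) (faceEdge k t (suc zero) b)
faceEdges-adjacent k t a b =
  (λ { (d≡d′ , _) → 0≢1+n (punchIn-injective k zero (suc zero) d≡d′) }) ,
  insertAt (b ∷ a ∷ []) k t , faceEdge-endpoint k t zero a b , faceEdge-endpoint k t (suc zero) b a

faceEdge-surjective : ∀ k e → k ≢ dir e → ∃₂ λ t j → ∃ λ b → e ≡ faceEdge k t j b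
faceEdge-surjective k (edge d l l₀) k≢d with removeAt (removeAt l k) (punchOut k≢d) in r≡
... | b ∷ [] = lookup l k , j , b , edge-≡ (sym (punchIn-punchOut k≢d)) (begin
  l                                                   ≡⟨ sym (insertAt-removeAt l k) ⟩
  insertAt w k (lookup l k)                           ≡⟨ cong (λ u → insertAt u k (lookup l k)) w≡ ⟩
  insertAt (insertAt (b ∷ []) j false) k (lookup l k) ∎)
  where
  open ≡-Reasoning
  j = punchOut k≢d
  w = removeAt l k
  wj≡false : lookup w j ≡ false
  wj≡false = trans (removeAt-punchOut l k≢d) l₀
  w≡ : w ≡ insertAt (b ∷ []) j false
  w≡ = begin
    w                                      ≡⟨ sym (insertAt-removeAt w j) ⟩
    insertAt (removeAt w j) j (lookup w j) ≡⟨ cong₂ (λ r x → insertAt r j x) r≡ wj≡false ⟩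
    insertAt (b ∷ []) j false              ∎

direction-k-or-faceEdge : ∀ k e → dir e ≡ k ⊎ ∃₂ λ t j → ∃ λ b → e ≡ faceEdge k t j b
direction-k-or-faceEdge k e with k ≟ dir e
... | yes k≡d = inj₁ (sym k≡d)
... | no k≢d  = inj₂ (faceEdge-surjective k e k≢d)

swapIf : Bool → Fin 2 → Fin 2
swapIf false j          = j
swapIf true  zero       = suc zero
swapIf true  (suc zero) = zero

swapIf-injective : ∀ p {j j′} → swapIf p j ≡ swapIf p j′ → j ≡ j′
swapIf-injective false eq = eq
swapIf-injective true {zero}     {zero}     _ = refl
swapIf-injective true {suc zero} {suc zero} _ = refl
swapIf-injective true {zero}     {suc zero} ()
swapIf-injective true {suc zero} {zero}     ()

-- punchIn c enumerates the two colors other than c; the phase p swaps them between the face's directions.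
faceColor : Color → Bool → Fin 2 → Color
faceColor c p j = punchIn c (swapIf p j)

faceColor-injective : ∀ c p {j j′} → faceColor c p j ≡ faceColor c p j′ → j ≡ j′
faceColor-injective c p = swapIf-injective p ∘ punchIn-injective c _ _

coloring : Fin 3 → Color → (Bool → Bool) → Edge → Color
coloring k c phase e with k ≟ dir e
... | yes _   = c
... | no k≢d = faceColor c (phase (lookup (low e) k)) (punchOut k≢d)

coloring-proper : ∀ k c phase → IsProper (coloring k c phase)
coloring-proper k c phase e g (e≉g , v , v∈e , v∈g) with k ≟ dir e | k ≟ dir g
... | yes k≡d | yes k≡d′ = ⊥-elim (e≉g (sharedEndpoint⇒SameEdge e g (trans (sym k≡d) k≡d′) v∈e v∈g))
... | yes _   | no k≢d′  = punchInᵢ≢i c (swapIf (phase (lookup (low g) k)) (punchOut k≢d′)) ∘ sym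
... | no k≢d  | yes _    = punchInᵢ≢i c (swapIf (phase (lookup (low e) k)) (punchOut k≢d))
... | no k≢d  | no k≢d′  = λ colors≡ →
  e≉g (sharedEndpoint⇒SameEdge e g (punchOut-injective k≢d k≢d′ (faceColor-injective c _ (subst
    (λ s → faceColor c (phase s) (punchOut k≢d) ≡ _) sameSide colors≡))) v∈e v∈g)
  where
  sameSide : lookup (low e) k ≡ lookup (low g) k
  sameSide = trans (sym (endpoint-lookup e k≢d v∈e)) (endpoint-lookup g k≢d′ v∈g)

coloring-faceEdge : ∀ k c phase t j b → coloring k c phase (faceEdge k t j b) ≡ faceColor c (phase t) j
coloring-faceEdge k c phase t j b with k ≟ punchIn k j
... | yes k≡d = ⊥-elim (punchInᵢ≢i k j (sym k≡d))
... | no k≢d  = cong₂ (λ s → faceColor c (phase s))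
  (insertAt-lookup _ k t) (trans (punchOut-cong k refl) (punchOut-punchIn k))

-- The edges of a 4-cycle: x₀, x₁ in one direction and y₀, y₁ in the other; each xᵢ meets each yⱼ.
record Square : Set where
  constructor square
  field x₀ x₁ y₀ y₁ : Maybe Color

at : Square → Fin 2 → Bool → Maybe Color
at (square x₀ x₁ y₀ y₁) zero       false = x₀
at (square x₀ x₁ y₀ y₁) zero       true  = x₁
at (square x₀ x₁ y₀ y₁) (suc zero) false = y₀
at (square x₀ x₁ y₀ y₁) (suc zero) true  = y₁

Compatible : Maybe Color → Maybe Color → Set
Compatible x y = ∀ c → x ≡ just c → y ≢ just c

SquareProper : Square → Set
SquareProper sq = ∀ a b → Compatible (at sq zero a) (at sq (suc zero) b)

Avoids : Square → Color → Bool → Set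
Avoids sq c p = ∀ j b → at sq j b ≢ just (faceColor c p j)

AvoidableWith : Square → Color → Set
AvoidableWith sq c = Σ Bool (Avoids sq c)

FailsAtMostOnce : ∀ {n} → Pred (Fin n) 0ℓ → Set
FailsAtMostOnce P = ∀ {c c′} → c ≢ c′ → P c ⊎ P c′

module _ {P : Pred Bool 0ℓ} (P? : Decidable P) where

  ∀-Bool? : Dec (∀ b → P b)
  ∀-Bool? = map′ (λ { (t , f) true → t ; (t , f) false → f }) (λ h → h true , h false)
    (P? true ×-dec P? false)

  ∃-Bool? : Dec (Σ Bool P)
  ∃-Bool? = map′ (λ { (inj₁ t) → true , t ; (inj₂ f) → false , f })
    (λ { (true , t) → inj₁ t ; (false , f) → inj₂ f }) (P? true ⊎-dec P? false)

∀-MaybeColor? : {P : Pred (Maybe Color) 0ℓ} → Decidable P → Dec (∀ x → P x)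
∀-MaybeColor? P? = map′ (λ { (n , j) nothing → n ; (n , j) (just c) → j c })
  (λ h → h nothing , λ c → h (just c)) (P? nothing ×-dec all? (λ (c : Color) → P? (just c)))

∀-Square? : {P : Pred Square 0ℓ} → Decidable P → Dec (∀ sq → P sq)
∀-Square? P? = map′ (λ h → λ { (square a b c d) → h a b c d }) (λ h a b c d → h (square a b c d))
  (∀-MaybeColor? λ a → ∀-MaybeColor? λ b → ∀-MaybeColor? λ c → ∀-MaybeColor? λ d → P? (square a b c d))

_≟ₘ_ : (x y : Maybe Color) → Dec (x ≡ y)
_≟ₘ_ = ≡-dec-Maybe _≟_

compatible? : ∀ x y → Dec (Compatible x y)
compatible? x y = all? λ (c : Color) → (x ≟ₘ just c) →-dec ¬? (y ≟ₘ just c)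

squareProper? : ∀ sq → Dec (SquareProper sq)
squareProper? sq = ∀-Bool? λ a → ∀-Bool? λ b → compatible? (at sq zero a) (at sq (suc zero) b)

avoidableWith? : ∀ sq c → Dec (AvoidableWith sq c)
avoidableWith? sq c =
  ∃-Bool? λ p → all? λ (j : Fin 2) → ∀-Bool? λ b → ¬? (at sq j b ≟ₘ just (faceColor c p j))

square-avoidable : ∀ sq → SquareProper sq → FailsAtMostOnce (AvoidableWith sq)
square-avoidable sq proper {c} {c′} = decided sq proper c c′
  where
  decided : ∀ sq → SquareProper sq → ∀ c c′ → c ≢ c′ → AvoidableWith sq c ⊎ AvoidableWith sq c′
  decided = from-yes (∀-Square? λ sq → squareProper? sq →-dec all? λ (c : Color) → all? λ (c′ : Color) →
    ¬? (c ≟ c′) →-dec (avoidableWith? sq c ⊎-dec avoidableWith? sq c′))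

common-witness : ∀ {n} {P Q : Pred (Fin (3 + n)) 0ℓ} → FailsAtMostOnce P → FailsAtMostOnce Q →
  ∃ λ c → P c × Q c
common-witness {P = P} {Q} P± Q± = [ from zero , from (suc zero) ]′ (P± λ ())
  where
  from : ∀ p → P p → ∃ λ c → P c × Q c
  from p Pp with Q± {p} (punchInᵢ≢i p zero ∘ sym) | Q± {p} (punchInᵢ≢i p (suc zero) ∘ sym)
  ... | inj₁ Qp | _       = p , Pp , Qp
  ... | inj₂ _  | inj₁ Qp = p , Pp , Qp
  ... | inj₂ Qa | inj₂ Qb with P± {punchIn p zero} {punchIn p (suc zero)}
                                  (0≢1+n ∘ punchIn-injective p zero (suc zero))
  ...   | inj₁ Pa = _ , Pa , Qa
  ...   | inj₂ Pb = _ , Pb , Qb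

faceSquare : PartialColoring → Fin 3 → Bool → Square
faceSquare φ k t = square (φ (faceEdge k t zero false))       (φ (faceEdge k t zero true))
                          (φ (faceEdge k t (suc zero) false)) (φ (faceEdge k t (suc zero) true))

at-faceSquare : ∀ φ k t j b → at (faceSquare φ k t) j b ≡ φ (faceEdge k t j b)
at-faceSquare φ k t zero       false = refl
at-faceSquare φ k t zero       true  = refl
at-faceSquare φ k t (suc zero) false = refl
at-faceSquare φ k t (suc zero) true  = refl

faceSquare-proper : ∀ φ → IsProperPartial φ → ∀ k t → SquareProper (faceSquare φ k t)
faceSquare-proper φ proper k t a b c x≡c y≡c = proper _ _ c c (faceEdges-adjacent k t a b)
  (trans (sym (at-faceSquare φ k t zero a)) x≡c)
  (trans (sym (at-faceSquare φ k t (suc zero) b)) y≡c) refl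

UncoloredDirection : PartialColoring → Fin 3 → Set
UncoloredDirection φ k = ∀ e c → φ e ≡ just c → dir e ≢ k

coloring-avoids : ∀ φ k c phase → UncoloredDirection φ k →
  (∀ t → Avoids (faceSquare φ k t) c (phase t)) → ∀ e x → φ e ≡ just x → coloring k c phase e ≢ x
coloring-avoids φ k c phase uncolored avoids e x φe≡x with direction-k-or-faceEdge k e
... | inj₁ d≡k                = λ _ → uncolored e x φe≡x d≡k
... | inj₂ (t , j , b , refl) = λ color≡x → avoids t j b (begin
  at (faceSquare φ k t) j b                    ≡⟨ at-faceSquare φ k t j b ⟩
  φ (faceEdge k t j b)                         ≡⟨ φe≡x ⟩
  just x                                       ≡⟨ cong just (sym color≡x) ⟩
  just (coloring k c phase (faceEdge k t j b)) ≡⟨ cong just (coloring-faceEdge k c phase t j b) ⟩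
  just (faceColor c (phase t) j)               ∎)
  where open ≡-Reasoning

uncoloredDirection⇒avoidable : ∀ φ → IsProperPartial φ → ∀ k → UncoloredDirection φ k → Avoidable φ
uncoloredDirection⇒avoidable φ proper k uncolored =
  fromCommonColor (common-witness (square-avoidable _ (faceSquare-proper φ proper k false))
                                  (square-avoidable _ (faceSquare-proper φ proper k true)))
  where
  fromCommonColor :
    (∃ λ c → AvoidableWith (faceSquare φ k false) c × AvoidableWith (faceSquare φ k true) c) → Avoidable φ
  fromCommonColor (c , (p₀ , avoids₀) , (p₁ , avoids₁)) =
    coloring k c phase , coloring-proper k c phase , coloring-avoids φ k c phase uncolored avoids
    where
    phase : Bool → Bool
    phase false = p₀
    phase true  = p₁
    avoids : ∀ t → Avoids (faceSquare φ k t) c (phase t)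
    avoids false = avoids₀
    avoids true  = avoids₁

third-direction : (i j : Fin 3) → ∃ λ k → k ≢ i × k ≢ j
third-direction = from-yes (all? λ (i : Fin 3) → all? λ (j : Fin 3) → any? λ (k : Fin 3) →
  ¬? (k ≟ i) ×-dec ¬? (k ≟ j))

lemma4p4 : (φ : PartialColoring) → IsProperPartial φ → (i j : Fin 3) →
    ColoredWithin φ i j → Avoidable φ
lemma4p4 φ proper i j within with third-direction i j
... | k , k≢i , k≢j = uncoloredDirection⇒avoidable φ proper k λ e c φe≡c d≡k →
  [ k≢i ∘ trans (sym d≡k) , k≢j ∘ trans (sym d≡k) ]′ (within e c φe≡c)
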